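{- For every $\varepsilon>0$ there is $\delta>0$ such that the following holds for every $n\ge1/\delta$. Let $L$ be a graph on $[n]=\{1,\dots,n\}$ and $V_1\cup V_2\cup V_3=[n]$ a partition. For $i,j\in\{1,2,3\}$ let $L_{i,j}$ be the set of edges of $L$ with one endpoint in $V_i$ and the other in $V_j$ (so $L_{i,i}$ is the set of edges of $L$ inside $V_i$). Suppose that $|L_{2,3}|\ge\max\{|L_{1,2}|,|L_{1,3}|\}$ and (i) $|V_i|\ge(\frac14-\delta)n$ for each $i\in\{1,2,3\}$; (ii) $|L_{1,2}|+|L_{1,3}|+|L_{2,3}|\ge(\frac1{16}-\delta)n^2$; (iii) for all distinct $h,i,j\in\{1,2,3\}$ there are at most $\delta n^4$ quadruples $(w,x,y,z)\in V_h\times V_i^2\times V_j$ with $wx\in L$ and $yz\in L$; (iv) for all distinct $i,j\in\{1,2,3\}$ there are at most $\delta n^3$ triples $(x,y,z)\in V_i^2\times V_j$ with $xy\in L$ and $xz\in L$. Let $B_v=L_{1,2}\cup L_{1,3}\cup L_{2,2}\cup L_{3,3}$ and let $M_v$ be the set of pairs $\{x,y\}$ with $x\in V_2$, $y\in V_3$ and $xy\notin L$. Then $|B_v|-\frac{9}{10}|M_v|\le\varepsilon n^2$.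
   Context: Graphs are simple $2$-uniform; $xy$ denotes the pair $\{x,y\}$.
   Formalization: The parameter ε ranges over the positive rationals, and the threshold δ is taken in the rationals. -}

module Defs where

open import Data.Nat using (ℕ; zero; suc; _+_; _*_; _^_)
open import Data.Nat using () renaming (_<?_ to _ℕ<?_)
open import Data.Bool using (Bool; true; false; if_then_else_; _∧_; not)
open import Data.Fin using (Fin; toℕ; _≟_)
open import Data.Fin as F using ()
open import Data.List using (map; allFin)
open import Data.Nat.ListAction using (sum)
open import Relation.Binary.PropositionalEquality using (_≡_)
open import Relation.Nullary.Decidable using (⌊_⌋)
open import Data.Integer using (+_)
open import Data.Rational using (ℚ; _/_)

record Graph (n : ℕ) : Set where
  field
    adj    : Fin n → Fin n → Bool
    sym    : ∀ x y → adj x y ≡ adj y x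
    irrefl : ∀ x → adj x x ≡ false
open Graph public

Partition3 : ℕ → Set
Partition3 n = Fin n → Fin 3

V1 V2 V3 : Fin 3
V1 = F.zero
V2 = F.suc F.zero
V3 = F.suc (F.suc F.zero)

Σ[_] : ∀ {n} → (Fin n → ℕ) → ℕ
Σ[_] {n} f = sum (map f (allFin n))

count : ∀ {n} → (Fin n → Bool) → ℕ
count p = Σ[ (λ i → if p i then 1 else 0) ]

module _ {n : ℕ} (L : Graph n) (P : Partition3 n) where

  inV : Fin 3 → Fin n → Bool
  inV i x = ⌊ P x ≟ i ⌋

  sizeV : Fin 3 → ℕ
  sizeV i = count (inV i)

  -- |L_{i,j}| for i ≠ j: each edge with one end in V_i and the other in V_j
  -- corresponds to exactly one ordered pair (x , y) ∈ V_i × V_j.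
  L-between : Fin 3 → Fin 3 → ℕ
  L-between i j = Σ[ (λ x → count (λ y → inV i x ∧ inV j y ∧ adj L x y)) ]

  L-inside : Fin 3 → ℕ
  L-inside i = Σ[ (λ x → count (λ y → inV i x ∧ inV i y ∧ adj L x y ∧ ⌊ toℕ x ℕ<? toℕ y ⌋)) ]

  -- |B_v| = |L_{1,2} ∪ L_{1,3} ∪ L_{2,2} ∪ L_{3,3}| (a disjoint union)
  sizeB : ℕ
  sizeB = L-between V1 V2 + L-between V1 V3 + L-inside V2 + L-inside V3

  sizeM : ℕ
  sizeM = Σ[ (λ x → count (λ y → inV V2 x ∧ inV V3 y ∧ not (adj L x y))) ]

  quads : Fin 3 → Fin 3 → Fin 3 → ℕ
  quads h i j = Σ[ (λ w → Σ[ (λ x → Σ[ (λ y → count (λ z →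
    inV h w ∧ inV i x ∧ inV i y ∧ inV j z ∧ adj L w x ∧ adj L y z))])]) ]

  triples : Fin 3 → Fin 3 → ℕ
  triples i j = Σ[ (λ x → Σ[ (λ y → count (λ z →
    inV i x ∧ inV i y ∧ inV j z ∧ adj L x y ∧ adj L x z))]) ]

ℚ[_] : ℕ → ℚ
ℚ[ m ] = + m / 1

module Submission where

-- Let 1/q ≤ ε and t = 500q, and call a vertex of V₂ high if it has at least |V₃|/t neighbours in V₃
-- (symmetrically for V₃); X₂, Y₂ and X₃, Y₃ are the low and high parts. Only o(n²) edges meet a low
-- vertex, so |L₂₃| ≲ |Y₂||Y₃|. By (iii) and the maximality of |L₂₃| also |L₁₂|, |L₁₃| = o(n²), so (ii)
-- gives |Y₂||Y₃| ≳ 0.056n², and as every part has about n/4 vertices, |X₂| ≤ 9|Y₃|/5. An edge inside V₂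
-- joins two low vertices or meets a high one, and by (iv) the latter are o(n²); hence
-- 10|L₂₂| ≲ 5|X₂|² ≤ 9|X₂||Y₃|. The pairs in X₂ × V₃ and Y₂ × X₃ are non-edges up to o(n²), so adding
-- the symmetric bound for L₃₃ gives 10|B_v| ≤ 9|M_v| + o(n²).

open import Data.Fin using (Fin)
open import Data.Nat using (ℕ)
open import Defs hiding (sym)

module FiniteSums where

  open import Data.Bool using (Bool; true; false; if_then_else_; _∧_; not; T)
  open import Data.Empty using (⊥; ⊥-elim)
  open import Data.Fin using (toℕ)
  open import Data.List using (List; []; _∷_; map; allFin; length)
  open import Data.List.Properties using (length-tabulate)
  open import Data.Nat using (_+_; _*_; _≤_; z≤n; _<?_)
  open import Data.Nat.ListAction using (sum)
  open import Data.Nat.Properties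
  open import Algebra.Properties.CommutativeSemigroup +-commutativeSemigroup
    using () renaming (interchange to +-interchange)
  open import Data.Unit using (tt)
  open import Relation.Binary.PropositionalEquality
  open import Relation.Nullary.Decidable using (⌊_⌋; toWitness)

  module _ {A : Set} where

    sum-map-mono : ∀ (xs : List A) {f g : A → ℕ} → (∀ x → f x ≤ g x) →
                   sum (map f xs) ≤ sum (map g xs)
    sum-map-mono []       f≤g = z≤n
    sum-map-mono (x ∷ xs) f≤g = +-mono-≤ (f≤g x) (sum-map-mono xs f≤g)

    sum-map-cong : ∀ (xs : List A) {f g : A → ℕ} → (∀ x → f x ≡ g x) →
                   sum (map f xs) ≡ sum (map g xs)
    sum-map-cong []       f≡g = refl
    sum-map-cong (x ∷ xs) f≡g = cong₂ _+_ (f≡g x) (sum-map-cong xs f≡g)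

    sum-map-+ : ∀ (xs : List A) (f g : A → ℕ) →
                sum (map (λ x → f x + g x) xs) ≡ sum (map f xs) + sum (map g xs)
    sum-map-+ []       f g = refl
    sum-map-+ (x ∷ xs) f g =
      trans (cong (f x + g x +_) (sum-map-+ xs f g)) (+-interchange (f x) (g x) _ _)

    sum-map-*ˡ : ∀ (xs : List A) (c : ℕ) (f : A → ℕ) →
                 sum (map (λ x → c * f x) xs) ≡ c * sum (map f xs)
    sum-map-*ˡ []       c f = sym (*-zeroʳ c)
    sum-map-*ˡ (x ∷ xs) c f =
      trans (cong (c * f x +_) (sum-map-*ˡ xs c f)) (sym (*-distribˡ-+ c (f x) _))

    sum-map-const : ∀ (xs : List A) (c : ℕ) → sum (map (λ _ → c) xs) ≡ length xs * c
    sum-map-const []       c = refl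
    sum-map-const (x ∷ xs) c = cong (c +_) (sum-map-const xs c)

  module _ {n : ℕ} where

    Σ-mono : {f g : Fin n → ℕ} → (∀ x → f x ≤ g x) → Σ[ f ] ≤ Σ[ g ]
    Σ-mono = sum-map-mono (allFin n)

    Σ-cong : {f g : Fin n → ℕ} → (∀ x → f x ≡ g x) → Σ[ f ] ≡ Σ[ g ]
    Σ-cong = sum-map-cong (allFin n)

    Σ-+ : (f g : Fin n → ℕ) → Σ[ (λ x → f x + g x) ] ≡ Σ[ f ] + Σ[ g ]
    Σ-+ = sum-map-+ (allFin n)

    Σ-*ˡ : (c : ℕ) (f : Fin n → ℕ) → Σ[ (λ x → c * f x) ] ≡ c * Σ[ f ]
    Σ-*ˡ = sum-map-*ˡ (allFin n)

    Σ-*ʳ : (c : ℕ) (f : Fin n → ℕ) → Σ[ (λ x → f x * c) ] ≡ Σ[ f ] * c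
    Σ-*ʳ c f = trans (Σ-cong (λ x → *-comm (f x) c)) (trans (Σ-*ˡ c f) (*-comm c Σ[ f ]))

    Σ-const : (c : ℕ) → Σ[ (λ (_ : Fin n) → c) ] ≡ n * c
    Σ-const c = trans (sum-map-const (allFin n) c) (cong (_* c) (length-tabulate {n = n} (λ x → x)))

    Σ-×-Σ : (f g : Fin n → ℕ) → Σ[ (λ x → Σ[ (λ y → f x * g y) ]) ] ≡ Σ[ f ] * Σ[ g ]
    Σ-×-Σ f g = trans (Σ-cong (λ x → Σ-*ˡ (f x) g)) (Σ-*ʳ Σ[ g ] f)

    Σ² : (Fin n → Fin n → ℕ) → ℕ
    Σ² f = Σ[ (λ x → Σ[ f x ]) ]

    Σ²-mono : {f g : Fin n → Fin n → ℕ} → (∀ x y → f x y ≤ g x y) → Σ² f ≤ Σ² g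
    Σ²-mono f≤g = Σ-mono (λ x → Σ-mono (f≤g x))

    Σ²-cong : {f g : Fin n → Fin n → ℕ} → (∀ x y → f x y ≡ g x y) → Σ² f ≡ Σ² g
    Σ²-cong f≡g = Σ-cong (λ x → Σ-cong (f≡g x))

    Σ²-+ : (f g : Fin n → Fin n → ℕ) → Σ² (λ x y → f x y + g x y) ≡ Σ² f + Σ² g
    Σ²-+ f g = trans (Σ-cong (λ x → Σ-+ (f x) (g x))) (Σ-+ _ _)

    Σ²-*ˡ : (c : Fin n → ℕ) (f : Fin n → Fin n → ℕ) →
            Σ² (λ x y → c x * f x y) ≡ Σ[ (λ x → c x * Σ[ f x ]) ]
    Σ²-*ˡ c f = Σ-cong (λ x → Σ-*ˡ (c x) (f x))

    Σ²-transpose : (f : Fin n → Fin n → ℕ) → Σ² f ≡ Σ² (λ y x → f x y)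
    Σ²-transpose f = go (allFin n)
      where
      go : (xs : List (Fin n)) → sum (map (λ x → Σ[ f x ]) xs) ≡ Σ[ (λ y → sum (map (λ x → f x y) xs)) ]
      go []       = sym (trans (Σ-const 0) (*-zeroʳ n))
      go (x ∷ xs) = trans (cong (Σ[ f x ] +_) (go xs)) (sym (Σ-+ (f x) _))

    Σ²-×-Σ² : (f g : Fin n → Fin n → ℕ) →
              Σ² (λ w x → Σ² (λ y z → f w x * g y z)) ≡ Σ² f * Σ² g
    Σ²-×-Σ² f g = trans (Σ²-cong (λ w x → trans (Σ²-*ˡ (λ _ → f w x) g) (Σ-*ˡ (f w x) _)))
                        (trans (Σ-cong (λ w → Σ-*ʳ (Σ² g) (f w))) (Σ-*ʳ (Σ² g) _))

  ⟦_⟧ : Bool → ℕ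
  ⟦ b ⟧ = if b then 1 else 0

  ⟦∧⟧ : ∀ a b → ⟦ a ∧ b ⟧ ≡ ⟦ a ⟧ * ⟦ b ⟧
  ⟦∧⟧ false b = refl
  ⟦∧⟧ true  b = sym (+-identityʳ ⟦ b ⟧)

  ⟦∧⟧≤⟦⟧ : ∀ a b → ⟦ a ∧ b ⟧ ≤ ⟦ a ⟧
  ⟦∧⟧≤⟦⟧ false b = z≤n
  ⟦∧⟧≤⟦⟧ true false = z≤n
  ⟦∧⟧≤⟦⟧ true true = ≤-refl

  ⟦⟧-split : ∀ a h → ⟦ a ⟧ ≡ ⟦ a ∧ not h ⟧ + ⟦ a ∧ h ⟧
  ⟦⟧-split false h     = refl
  ⟦⟧-split true  false = refl
  ⟦⟧-split true  true  = refl

  ⟦⟧*-monoʳ-≤ : ∀ b {m k} → (T b → m ≤ k) → ⟦ b ⟧ * m ≤ ⟦ b ⟧ * k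
  ⟦⟧*-monoʳ-≤ false m≤k = z≤n
  ⟦⟧*-monoʳ-≤ true  m≤k = *-monoʳ-≤ 1 (m≤k tt)

  double-increasing-pairs≤square : ∀ {n} (f : Fin n → Bool) →
    2 * Σ² (λ x y → ⟦ f x ∧ f y ∧ ⌊ toℕ x <? toℕ y ⌋ ⟧) ≤ count f * count f
  double-increasing-pairs≤square f = begin
    2 * Σ² g                                   ≡⟨ cong (Σ² g +_) (+-identityʳ (Σ² g)) ⟩
    Σ² g + Σ² g                                ≡⟨ cong (Σ² g +_) (Σ²-transpose g) ⟩
    Σ² g + Σ² (λ x y → g y x)                  ≡⟨ Σ²-+ g (λ x y → g y x) ⟨
    Σ² (λ x y → g x y + g y x)                 ≤⟨ Σ²-mono (λ x y → pair-bound (f x) (f y) _ _ (lt-asym x y)) ⟩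
    Σ² (λ x y → ⟦ f x ⟧ * ⟦ f y ⟧)             ≡⟨ Σ-×-Σ (λ x → ⟦ f x ⟧) (λ y → ⟦ f y ⟧) ⟩
    count f * count f                          ∎
    where
    open ≤-Reasoning
    lt : _ → _ → Bool
    lt x y = ⌊ toℕ x <? toℕ y ⌋
    g : _ → _ → ℕ
    g x y = ⟦ f x ∧ f y ∧ lt x y ⟧
    lt-asym : ∀ x y → T (lt x y) → T (lt y x) → ⊥
    lt-asym x y x<y y<x = <-asym (toWitness x<y) (toWitness y<x)
    pair-bound : ∀ a b l l′ → (T l → T l′ → ⊥) →
                 ⟦ a ∧ b ∧ l ⟧ + ⟦ b ∧ a ∧ l′ ⟧ ≤ ⟦ a ⟧ * ⟦ b ⟧
    pair-bound false false _     _     _     = z≤n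
    pair-bound false true  _     _     _     = z≤n
    pair-bound true  false _     _     _     = z≤n
    pair-bound true  true  true  true  ¬both = ⊥-elim (¬both tt tt)
    pair-bound true  true  true  false _     = ≤-refl
    pair-bound true  true  false true  _     = ≤-refl
    pair-bound true  true  false false _     = z≤n

module Counting {n : ℕ} (L : Graph n) (P : Partition3 n) where

  open import Algebra.Bundles using (CommutativeMonoid)
  open import Data.Bool using (Bool; true; false; _∧_; not; T)
  open import Data.Bool.Properties using (∧-commutativeMonoid; T-∧)
  open import Algebra.Properties.CommutativeSemigroup
    (CommutativeMonoid.commutativeSemigroup ∧-commutativeMonoid)
    using () renaming (x∙yz≈y∙xz to ∧-left-swap)
  open import Data.Fin using (toℕ) renaming (zero to 0F; suc to sucF)
  open import Data.Nat using (_+_; _*_; _≤_; _<_; z≤n; s≤s; _≤?_; _<?_)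
  open import Data.Nat.Properties
  open import Data.Nat.Tactic.RingSolver using (solve-∀)
  open import Data.Product using (proj₂)
  open import Function.Base using (_∘_)
  open import Function.Bundles using (Equivalence)
  open import Relation.Binary.PropositionalEquality
  open import Relation.Nullary.Decidable using (⌊_⌋; toWitness; toWitnessFalse)
  open FiniteSums

  V : Fin 3 → Fin n → Bool
  V = inV L P

  deg : Fin 3 → Fin n → ℕ
  deg j x = count (λ y → V j y ∧ adj L x y)

  sizeV-total : sizeV L P V1 + sizeV L P V2 + sizeV L P V3 ≡ n
  sizeV-total = begin
    sizeV L P V1 + sizeV L P V2 + sizeV L P V3
      ≡⟨ cong (_+ sizeV L P V3) (Σ-+ (λ x → ⟦ V V1 x ⟧) (λ x → ⟦ V V2 x ⟧)) ⟨
    Σ[ (λ x → ⟦ V V1 x ⟧ + ⟦ V V2 x ⟧) ] + sizeV L P V3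
      ≡⟨ Σ-+ (λ x → ⟦ V V1 x ⟧ + ⟦ V V2 x ⟧) (λ x → ⟦ V V3 x ⟧) ⟨
    Σ[ (λ x → ⟦ V V1 x ⟧ + ⟦ V V2 x ⟧ + ⟦ V V3 x ⟧) ]
      ≡⟨ Σ-cong one-part ⟩
    Σ[ (λ (_ : Fin n) → 1) ]
      ≡⟨ trans (Σ-const {n} 1) (*-identityʳ n) ⟩
    n ∎
    where
    open ≡-Reasoning
    one-part : ∀ x → ⟦ V V1 x ⟧ + ⟦ V V2 x ⟧ + ⟦ V V3 x ⟧ ≡ 1
    one-part x with P x
    ... | 0F             = refl
    ... | sucF 0F        = refl
    ... | sucF (sucF 0F) = refl

  L-between-sym : ∀ i j → L-between L P i j ≡ L-between L P j i
  L-between-sym i j = trans (Σ²-transpose (λ x y → ⟦ V i x ∧ V j y ∧ adj L x y ⟧)) (Σ²-cong swap)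
    where
    swap : ∀ y x → ⟦ V i x ∧ V j y ∧ adj L x y ⟧ ≡ ⟦ V j y ∧ V i x ∧ adj L y x ⟧
    swap y x rewrite Graph.sym L x y = cong ⟦_⟧ (∧-left-swap (V i x) (V j y) (adj L y x))

  quads≡L-between*L-between : ∀ h i j → quads L P h i j ≡ L-between L P h i * L-between L P i j
  quads≡L-between*L-between h i j =
    trans (Σ²-cong λ w x → Σ²-cong λ y z → split-conjunction (V h w) (V i x) (V i y) (V j z) _ _)
          (Σ²-×-Σ² (λ w x → ⟦ V h w ∧ V i x ∧ adj L w x ⟧) (λ y z → ⟦ V i y ∧ V j z ∧ adj L y z ⟧))
    where
    split-conjunction : ∀ a b c d e f →
                        ⟦ a ∧ b ∧ c ∧ d ∧ e ∧ f ⟧ ≡ ⟦ a ∧ b ∧ e ⟧ * ⟦ c ∧ d ∧ f ⟧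
    split-conjunction false _     _     _     _ _ = refl
    split-conjunction true  false _     _     _ _ = refl
    split-conjunction true  true  false _     e _ = sym (*-zeroʳ ⟦ e ⟧)
    split-conjunction true  true  true  false e _ = sym (*-zeroʳ ⟦ e ⟧)
    split-conjunction true  true  true  true  e f = ⟦∧⟧ e f

  triples≡Σdeg*deg : ∀ i j → triples L P i j ≡ Σ[ (λ x → ⟦ V i x ⟧ * (deg i x * deg j x)) ]
  triples≡Σdeg*deg i j = Σ-cong λ x → begin
    Σ²  (λ y z → ⟦ V i x ∧ V i y ∧ V j z ∧ adj L x y ∧ adj L x z ⟧)
      ≡⟨ Σ²-cong (λ y z → split-conjunction (V i x) (V i y) (V j z) (adj L x y) (adj L x z)) ⟩
    Σ²  (λ y z → ⟦ V i x ⟧ * (nbr i x y * nbr j x z))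
      ≡⟨ trans (Σ²-*ˡ (λ _ → ⟦ V i x ⟧) (λ y z → nbr i x y * nbr j x z))
               (Σ-*ˡ ⟦ V i x ⟧ (λ y → Σ[ (λ z → nbr i x y * nbr j x z) ])) ⟩
    ⟦ V i x ⟧ * Σ² (λ y z → nbr i x y * nbr j x z)
      ≡⟨ cong (⟦ V i x ⟧ *_) (Σ-×-Σ (nbr i x) (nbr j x)) ⟩
    ⟦ V i x ⟧ * (deg i x * deg j x) ∎
    where
    open ≡-Reasoning
    nbr : Fin 3 → Fin n → Fin n → ℕ
    nbr k x y = ⟦ V k y ∧ adj L x y ⟧
    split-conjunction : ∀ a b c e f → ⟦ a ∧ b ∧ c ∧ e ∧ f ⟧ ≡ ⟦ a ⟧ * (⟦ b ∧ e ⟧ * ⟦ c ∧ f ⟧)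
    split-conjunction false _     _     _ _ = refl
    split-conjunction true  false _     e _ = refl
    split-conjunction true  true  false e _ = sym (trans (+-identityʳ _) (*-zeroʳ ⟦ e ⟧))
    split-conjunction true  true  true  e f = trans (⟦∧⟧ e f) (sym (+-identityʳ _))

  module DegreeSplit (i j : Fin 3) (t : ℕ) where

    isHigh : Fin n → Bool
    isHigh x = ⌊ sizeV L P j ≤? t * deg j x ⌋

    low high : Fin n → Bool
    low  x = V i x ∧ not (isHigh x)
    high x = V i x ∧ isHigh x

    #low #high : ℕ
    #low  = count low
    #high = count high

    lowDegree highDegree : ℕ
    lowDegree  = Σ[ (λ x → ⟦ low x ⟧ * deg j x) ]
    highDegree = Σ[ (λ x → ⟦ high x ⟧ * deg i x) ]

    sizeV≡#low+#high : sizeV L P i ≡ #low + #high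
    sizeV≡#low+#high = trans (Σ-cong (λ x → ⟦⟧-split (V i x) (isHigh x)))
                             (Σ-+ (λ x → ⟦ low x ⟧) (λ x → ⟦ high x ⟧))

    few-neighbours : ∀ x → T (low x) → t * deg j x < sizeV L P j
    few-neighbours x x-low = ≰⇒> (toWitnessFalse (proj₂ (Equivalence.to (T-∧ {V i x}) x-low)))

    many-neighbours : ∀ x → T (high x) → sizeV L P j ≤ t * deg j x
    many-neighbours x x-high = toWitness (proj₂ (Equivalence.to (T-∧ {V i x}) x-high))

    #low≤sizeV : #low ≤ sizeV L P i
    #low≤sizeV = ≤-trans (m≤m+n #low #high) (≤-reflexive (sym sizeV≡#low+#high))

    #high≤sizeV : #high ≤ sizeV L P i
    #high≤sizeV = ≤-trans (m≤n+m #high #low) (≤-reflexive (sym sizeV≡#low+#high))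

    lowDegree*t≤#low*sizeV : lowDegree * t ≤ #low * sizeV L P j
    lowDegree*t≤#low*sizeV = begin
      lowDegree * t                           ≡⟨ Σ-*ʳ t (λ x → ⟦ low x ⟧ * deg j x) ⟨
      Σ[ (λ x → ⟦ low x ⟧ * deg j x * t) ]    ≤⟨ Σ-mono low-bound ⟩
      Σ[ (λ x → ⟦ low x ⟧ * sizeV L P j) ]    ≡⟨ Σ-*ʳ (sizeV L P j) (λ x → ⟦ low x ⟧) ⟩
      #low * sizeV L P j                      ∎
      where
      open ≤-Reasoning
      low-bound : ∀ x → ⟦ low x ⟧ * deg j x * t ≤ ⟦ low x ⟧ * sizeV L P j
      low-bound x = begin
        ⟦ low x ⟧ * deg j x * t    ≡⟨ trans (*-assoc ⟦ low x ⟧ (deg j x) t) (cong (⟦ low x ⟧ *_) (*-comm (deg j x) t)) ⟩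
        ⟦ low x ⟧ * (t * deg j x)  ≤⟨ ⟦⟧*-monoʳ-≤ (low x) (<⇒≤ ∘ few-neighbours x) ⟩
        ⟦ low x ⟧ * sizeV L P j    ∎

    highDegree*sizeV≤triples*t : highDegree * sizeV L P j ≤ triples L P i j * t
    highDegree*sizeV≤triples*t = begin
      highDegree * s                                      ≡⟨ Σ-*ʳ s (λ x → ⟦ high x ⟧ * deg i x) ⟨
      Σ[ (λ x → ⟦ high x ⟧ * deg i x * s) ]                ≤⟨ Σ-mono high-bound ⟩
      Σ[ (λ x → ⟦ V i x ⟧ * (deg i x * deg j x) * t) ]     ≡⟨ Σ-*ʳ t (λ x → ⟦ V i x ⟧ * (deg i x * deg j x)) ⟩
      Σ[ (λ x → ⟦ V i x ⟧ * (deg i x * deg j x)) ] * t     ≡⟨ cong (_* t) (triples≡Σdeg*deg i j) ⟨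
      triples L P i j * t                                 ∎
      where
      open ≤-Reasoning
      s = sizeV L P j
      high-bound : ∀ x → ⟦ high x ⟧ * deg i x * s ≤ ⟦ V i x ⟧ * (deg i x * deg j x) * t
      high-bound x = begin
        ⟦ high x ⟧ * deg i x * s               ≡⟨ *-assoc ⟦ high x ⟧ (deg i x) s ⟩
        ⟦ high x ⟧ * (deg i x * s)             ≤⟨ ⟦⟧*-monoʳ-≤ (high x) (*-monoʳ-≤ (deg i x) ∘ many-neighbours x) ⟩
        ⟦ high x ⟧ * (deg i x * (t * deg j x)) ≤⟨ *-monoˡ-≤ _ (⟦∧⟧≤⟦⟧ (V i x) (isHigh x)) ⟩
        ⟦ V i x ⟧ * (deg i x * (t * deg j x))  ≡⟨ rearrange ⟦ V i x ⟧ (deg i x) (deg j x) t ⟩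
        ⟦ V i x ⟧ * (deg i x * deg j x) * t    ∎
        where
        rearrange : ∀ a d e t → a * (d * (t * e)) ≡ a * (d * e) * t
        rearrange = solve-∀

    double-L-inside≤#low²+4*highDegree : 2 * L-inside L P i ≤ #low * #low + 4 * highDegree
    double-L-inside≤#low²+4*highDegree = begin
      2 * L-inside L P i                             ≤⟨ *-monoʳ-≤ 2 (Σ²-mono edge-bound) ⟩
      2 * Σ² (λ x y → lowPair x y + (highEdge x y + highEdge y x))
        ≡⟨ cong (2 *_) (trans (Σ²-+ lowPair _) (cong (Σ² lowPair +_) (Σ²-+ highEdge (λ x y → highEdge y x)))) ⟩
      2 * (Σ² lowPair + (Σ² highEdge + Σ² (λ x y → highEdge y x)))
        ≡⟨ cong₂ (λ e e′ → 2 * (Σ² lowPair + (e + e′)))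
                 highEdges (trans (sym (Σ²-transpose highEdge)) highEdges) ⟩
      2 * (Σ² lowPair + (highDegree + highDegree))   ≡⟨ distribute (Σ² lowPair) highDegree ⟩
      2 * Σ² lowPair + 4 * highDegree                ≤⟨ +-monoˡ-≤ _ (double-increasing-pairs≤square low) ⟩
      #low * #low + 4 * highDegree                   ∎
      where
      open ≤-Reasoning
      lowPair highEdge : Fin n → Fin n → ℕ
      lowPair x y  = ⟦ low x ∧ low y ∧ ⌊ toℕ x <? toℕ y ⌋ ⟧
      highEdge x y = ⟦ high x ⟧ * ⟦ V i y ∧ adj L x y ⟧
      distribute : ∀ p e → 2 * (p + (e + e)) ≡ 2 * p + 4 * e
      distribute = solve-∀
      highEdges : Σ² highEdge ≡ highDegree
      highEdges = Σ²-*ˡ (λ x → ⟦ high x ⟧) (λ x y → ⟦ V i y ∧ adj L x y ⟧)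
      edge-cases : ∀ a b hx hy e l →
        ⟦ a ∧ b ∧ e ∧ l ⟧ ≤
        ⟦ (a ∧ not hx) ∧ (b ∧ not hy) ∧ l ⟧ + (⟦ a ∧ hx ⟧ * ⟦ b ∧ e ⟧ + ⟦ b ∧ hy ⟧ * ⟦ a ∧ e ⟧)
      edge-cases false _     _     _     _     _     = z≤n
      edge-cases true  false _     _     _     _     = z≤n
      edge-cases true  true  _     _     false _     = z≤n
      edge-cases true  true  _     _     true  false = z≤n
      edge-cases true  true  true  _     true  true  = s≤s z≤n
      edge-cases true  true  false true  true  true  = s≤s z≤n
      edge-cases true  true  false false true  true  = s≤s z≤n
      edge-bound : ∀ x y → ⟦ V i x ∧ V i y ∧ adj L x y ∧ ⌊ toℕ x <? toℕ y ⌋ ⟧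
                           ≤ lowPair x y + (highEdge x y + highEdge y x)
      edge-bound x y rewrite Graph.sym L y x =
        edge-cases (V i x) (V i y) (isHigh x) (isHigh y) (adj L x y) ⌊ toℕ x <? toℕ y ⌋

  module CrossSplit (t : ℕ) where
    module S₂ = DegreeSplit V2 V3 t
    module S₃ = DegreeSplit V3 V2 t

    lowEdge : Fin n → Fin n → ℕ
    lowEdge x y = ⟦ S₂.low x ⟧ * ⟦ V V3 y ∧ adj L x y ⟧ + ⟦ S₃.low y ⟧ * ⟦ V V2 x ∧ adj L y x ⟧

    Σ²lowEdge≡lowDegrees : Σ² lowEdge ≡ S₂.lowDegree + S₃.lowDegree
    Σ²lowEdge≡lowDegrees = trans (Σ²-+ from₂ from₃) (cong₂ _+_
      (Σ²-*ˡ (λ x → ⟦ S₂.low x ⟧) (λ x y → ⟦ V V3 y ∧ adj L x y ⟧))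
      (trans (Σ²-transpose from₃) (Σ²-*ˡ (λ y → ⟦ S₃.low y ⟧) (λ y x → ⟦ V V2 x ∧ adj L y x ⟧))))
      where
      from₂ from₃ : Fin n → Fin n → ℕ
      from₂ x y = ⟦ S₂.low x ⟧ * ⟦ V V3 y ∧ adj L x y ⟧
      from₃ x y = ⟦ S₃.low y ⟧ * ⟦ V V2 x ∧ adj L y x ⟧

    L₂₃≤#high₂*#high₃+lowDegrees :
      L-between L P V2 V3 ≤ S₂.#high * S₃.#high + (S₂.lowDegree + S₃.lowDegree)
    L₂₃≤#high₂*#high₃+lowDegrees = begin
      L-between L P V2 V3                                ≤⟨ Σ²-mono edge-bound ⟩
      Σ² (λ x y → highPair x y + lowEdge x y)            ≡⟨ Σ²-+ highPair lowEdge ⟩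
      Σ² highPair + Σ² lowEdge                           ≡⟨ cong₂ _+_ (Σ-×-Σ (λ x → ⟦ S₂.high x ⟧) (λ y → ⟦ S₃.high y ⟧))
                                                                      Σ²lowEdge≡lowDegrees ⟩
      S₂.#high * S₃.#high + (S₂.lowDegree + S₃.lowDegree) ∎
      where
      open ≤-Reasoning
      highPair : Fin n → Fin n → ℕ
      highPair x y = ⟦ S₂.high x ⟧ * ⟦ S₃.high y ⟧
      edge-cases : ∀ a₂ a₃ h₂ h₃ e → ⟦ a₂ ∧ a₃ ∧ e ⟧ ≤
        ⟦ a₂ ∧ h₂ ⟧ * ⟦ a₃ ∧ h₃ ⟧ + (⟦ a₂ ∧ not h₂ ⟧ * ⟦ a₃ ∧ e ⟧ + ⟦ a₃ ∧ not h₃ ⟧ * ⟦ a₂ ∧ e ⟧)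
      edge-cases false _     _     _     _     = z≤n
      edge-cases true  false _     _     _     = z≤n
      edge-cases true  true  _     _     false = z≤n
      edge-cases true  true  false _     true  = s≤s z≤n
      edge-cases true  true  true  true  true  = s≤s z≤n
      edge-cases true  true  true  false true  = s≤s z≤n
      edge-bound : ∀ x y → ⟦ V V2 x ∧ V V3 y ∧ adj L x y ⟧ ≤ highPair x y + lowEdge x y
      edge-bound x y rewrite Graph.sym L y x =
        edge-cases (V V2 x) (V V3 y) (S₂.isHigh x) (S₃.isHigh y) (adj L x y)

    #low₂*sizeV₃+#high₂*#low₃≤sizeM+lowDegrees :
      S₂.#low * sizeV L P V3 + S₂.#high * S₃.#low ≤ sizeM L P + (S₂.lowDegree + S₃.lowDegree)
    #low₂*sizeV₃+#high₂*#low₃≤sizeM+lowDegrees = begin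
      S₂.#low * sizeV L P V3 + S₂.#high * S₃.#low
        ≡⟨ cong₂ _+_ (Σ-×-Σ (λ x → ⟦ S₂.low x ⟧) (λ y → ⟦ V V3 y ⟧))
                     (Σ-×-Σ (λ x → ⟦ S₂.high x ⟧) (λ y → ⟦ S₃.low y ⟧)) ⟨
      Σ² lowAny + Σ² highLow                            ≡⟨ Σ²-+ lowAny highLow ⟨
      Σ² (λ x y → lowAny x y + highLow x y)             ≤⟨ Σ²-mono pair-bound ⟩
      Σ² (λ x y → missing x y + lowEdge x y)            ≡⟨ Σ²-+ missing lowEdge ⟩
      sizeM L P + Σ² lowEdge                            ≡⟨ cong (sizeM L P +_) Σ²lowEdge≡lowDegrees ⟩
      sizeM L P + (S₂.lowDegree + S₃.lowDegree)         ∎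
      where
      open ≤-Reasoning
      lowAny highLow missing : Fin n → Fin n → ℕ
      lowAny x y  = ⟦ S₂.low x ⟧ * ⟦ V V3 y ⟧
      highLow x y = ⟦ S₂.high x ⟧ * ⟦ S₃.low y ⟧
      missing x y = ⟦ V V2 x ∧ V V3 y ∧ not (adj L x y) ⟧
      pair-cases : ∀ a₂ a₃ h₂ h₃ e →
        ⟦ a₂ ∧ not h₂ ⟧ * ⟦ a₃ ⟧ + ⟦ a₂ ∧ h₂ ⟧ * ⟦ a₃ ∧ not h₃ ⟧ ≤
        ⟦ a₂ ∧ a₃ ∧ not e ⟧ + (⟦ a₂ ∧ not h₂ ⟧ * ⟦ a₃ ∧ e ⟧ + ⟦ a₃ ∧ not h₃ ⟧ * ⟦ a₂ ∧ e ⟧)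
      pair-cases false _     _     _     _     = z≤n
      pair-cases true  false false _     _     = z≤n
      pair-cases true  false true  _     _     = z≤n
      pair-cases true  true  false _     false = s≤s z≤n
      pair-cases true  true  false _     true  = s≤s z≤n
      pair-cases true  true  true  true  _     = z≤n
      pair-cases true  true  true  false false = s≤s z≤n
      pair-cases true  true  true  false true  = s≤s z≤n
      pair-bound : ∀ x y → lowAny x y + highLow x y ≤ missing x y + lowEdge x y
      pair-bound x y rewrite Graph.sym L y x =
        pair-cases (V V2 x) (V V3 y) (S₂.isHigh x) (S₃.isHigh y) (adj L x y)

module Estimates where

  open import Data.Nat using (_+_; _*_; _^_; _≤_; _<_; z≤n; s≤s)
  open import Data.Nat.Base using (>-nonZero)
  open import Data.Nat.Properties
  open import Data.Nat.Tactic.RingSolver using (solve-∀)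
  open import Data.Product using (_,_)
  open import Data.Sum using ([_,_]′)
  open import Relation.Binary.PropositionalEquality

  *-cancelˡ-≤-pos : ∀ k {a b} → 0 < k → k * a ≤ k * b → a ≤ b
  *-cancelˡ-≤-pos k 0<k = *-cancelˡ-≤ k {{>-nonZero 0<k}}

  square-cancel-≤ : ∀ {a b} → a * a ≤ b * b → a ≤ b
  square-cancel-≤ a²≤b² = ≮⇒≥ (λ b<a → <⇒≱ (*-mono-< b<a b<a) a²≤b²)

  4mn≤[m+n]² : ∀ m n → 4 * (m * n) ≤ (m + n) * (m + n)
  4mn≤[m+n]² m n = [ ordered , (λ n≤m → subst₂ _≤_ (cong (4 *_) (*-comm n m)) (swap n m) (ordered n≤m)) ]′
                     (≤-total m n)
    where
    swap : ∀ m n → (m + n) * (m + n) ≡ (n + m) * (n + m)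
    swap m n = cong₂ _*_ (+-comm m n) (+-comm m n)
    ordered : ∀ {m n} → m ≤ n → 4 * (m * n) ≤ (m + n) * (m + n)
    ordered {m} m≤n with m≤n⇒∃[o]m+o≡n m≤n
    ... | d , refl = ≤-trans (m≤m+n _ (d * d)) (≤-reflexive (expand m d))
      where
      expand : ∀ m d → 4 * (m * (m + d)) + d * d ≡ (m + (m + d)) * (m + (m + d))
      expand = solve-∀

  -- s ≥ (1/4 − 1/K) n with K ≥ 100 gives s ≥ 0.24 n
  quarter-part-lower-bound : ∀ {K n s} → 100 ≤ K → K * n ≤ 4 * K * s + 4 * n → 6 * n ≤ 25 * s
  quarter-part-lower-bound {K} {n} {s} 100≤K part =
    *-cancelˡ-≤-pos 16 (s≤s z≤n) (*-cancelˡ-≤-pos K (≤-trans (s≤s z≤n) 100≤K) (+-cancelʳ-≤ (4 * (K * n)) _ _ (begin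
      K * (16 * (6 * n)) + 4 * (K * n)     ≡⟨ e₁ K n ⟩
      100 * (K * n)                        ≤⟨ *-monoʳ-≤ 100 part ⟩
      100 * (4 * K * s + 4 * n)            ≡⟨ e₂ K s n ⟩
      K * (16 * (25 * s)) + 4 * (100 * n)  ≤⟨ +-monoʳ-≤ (K * (16 * (25 * s))) (*-monoʳ-≤ 4 (*-monoˡ-≤ n 100≤K)) ⟩
      K * (16 * (25 * s)) + 4 * (K * n)    ∎)))
    where
    open ≤-Reasoning
    e₁ : ∀ K n → K * (16 * (6 * n)) + 4 * (K * n) ≡ 100 * (K * n)
    e₁ = solve-∀
    e₂ : ∀ K s n → 100 * (4 * K * s + 4 * n) ≡ K * (16 * (25 * s)) + 4 * (100 * n)
    e₂ = solve-∀

  quarter-part-complement-bound : ∀ {K n s y} → 400 ≤ K → y + s ≤ n → K * n ≤ 4 * K * s + 4 * n →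
                                  400 * y ≤ 301 * n
  quarter-part-complement-bound {K} {n} {s} {y} 400≤K y+s≤n part =
    *-cancelˡ-≤-pos K (≤-trans (s≤s z≤n) 400≤K) (+-cancelʳ-≤ (100 * (K * n)) _ _ (begin
      K * (400 * y) + 100 * (K * n)            ≤⟨ +-monoʳ-≤ (K * (400 * y)) (*-monoʳ-≤ 100 part) ⟩
      K * (400 * y) + 100 * (4 * K * s + 4 * n) ≡⟨ e₁ K y s n ⟩
      400 * (K * (y + s)) + 400 * n            ≤⟨ +-mono-≤ (*-monoʳ-≤ 400 (*-monoʳ-≤ K y+s≤n)) (*-monoˡ-≤ n 400≤K) ⟩
      400 * (K * n) + K * n                    ≡⟨ e₂ K n ⟩
      K * (301 * n) + 100 * (K * n)            ∎))
    where
    open ≤-Reasoning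
    e₁ : ∀ K y s n → K * (400 * y) + 100 * (4 * K * s + 4 * n) ≡ 400 * (K * (y + s)) + 400 * n
    e₁ = solve-∀
    e₂ : ∀ K n → 400 * (K * n) + K * n ≡ K * (301 * n) + 100 * (K * n)
    e₂ = solve-∀

  sparse-product-factor-bound : ∀ {K a l m N} → a * a ≤ K → K * (l * m) ≤ N * N → l ≤ m → a * l ≤ N
  sparse-product-factor-bound {K} {a} {l} {m} {N} a²≤K sparse l≤m = square-cancel-≤ (begin
    (a * l) * (a * l) ≡⟨ [m*n]*[o*p]≡[m*o]*[n*p] a l a l ⟩
    (a * a) * (l * l) ≤⟨ *-mono-≤ a²≤K (*-monoʳ-≤ l l≤m) ⟩
    K * (l * m)       ≤⟨ sparse ⟩
    N * N             ∎)
    where open ≤-Reasoning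

  low-degree-sums-bound : ∀ {t e₂ e₃ α β s₂ s₃ n} → e₂ * t ≤ α * s₃ → e₃ * t ≤ β * s₂ →
                          α + β ≤ n → s₂ ≤ n → s₃ ≤ n → (e₂ + e₃) * t ≤ n * n
  low-degree-sums-bound {t} {e₂} {e₃} {α} {β} {s₂} {s₃} {n} h₂ h₃ α+β≤n s₂≤n s₃≤n = begin
    (e₂ + e₃) * t      ≡⟨ *-distribʳ-+ t e₂ e₃ ⟩
    e₂ * t + e₃ * t    ≤⟨ +-mono-≤ h₂ h₃ ⟩
    α * s₃ + β * s₂    ≤⟨ +-mono-≤ (*-monoʳ-≤ α s₃≤n) (*-monoʳ-≤ β s₂≤n) ⟩
    α * n + β * n      ≡⟨ *-distribʳ-+ n α β ⟨
    (α + β) * n        ≤⟨ *-monoˡ-≤ n α+β≤n ⟩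
    n * n              ∎
    where open ≤-Reasoning

  high-degree-sum-bound : ∀ {K n s E r t} → 0 < n → K * r ≤ n * (n * n) → E * s ≤ r * t →
                          6 * n ≤ 25 * s → 6 * K * E ≤ 25 * t * (n * n)
  high-degree-sum-bound {K} {n} {s} {E} {r} {t} 0<n sparse E*s≤r*t 6n≤25s = *-cancelˡ-≤-pos n 0<n (begin
    n * (6 * K * E)           ≡⟨ e₁ n K E ⟩
    6 * n * (K * E)           ≤⟨ *-monoˡ-≤ (K * E) 6n≤25s ⟩
    25 * s * (K * E)          ≡⟨ e₂ s K E ⟩
    25 * (K * (E * s))        ≤⟨ *-monoʳ-≤ 25 (*-monoʳ-≤ K E*s≤r*t) ⟩
    25 * (K * (r * t))        ≡⟨ e₃ K r t ⟩
    25 * t * (K * r)          ≤⟨ *-monoʳ-≤ (25 * t) sparse ⟩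
    25 * t * (n * (n * n))    ≡⟨ e₄ t n ⟩
    n * (25 * t * (n * n))    ∎)
    where
    open ≤-Reasoning
    e₁ : ∀ n K E → n * (6 * K * E) ≡ 6 * n * (K * E)
    e₁ = solve-∀
    e₂ : ∀ s K E → 25 * s * (K * E) ≡ 25 * (K * (E * s))
    e₂ = solve-∀
    e₃ : ∀ K r t → 25 * (K * (r * t)) ≡ 25 * t * (K * r)
    e₃ = solve-∀
    e₄ : ∀ t n → 25 * t * (n * (n * n)) ≡ n * (25 * t * (n * n))
    e₄ = solve-∀

  high-product-lower-bound : ∀ {K x l₁ l₂ l₃ p e} → 8000 ≤ K →
    K * x ≤ 16 * K * (l₁ + l₂ + l₃) + 16 * x → l₃ ≤ p + e →
    500 * l₁ ≤ x → 500 * l₂ ≤ x → 500 * e ≤ x → 451 * x ≤ 8000 * p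
  high-product-lower-bound {K} {x} {l₁} {l₂} {l₃} {p} {e} 8000≤K dense l₃≤p+e l₁-small l₂-small e-small =
    *-cancelˡ-≤-pos K (≤-trans (s≤s z≤n) 8000≤K) (+-cancelʳ-≤ (49 * (K * x)) _ _ (begin
      K * (451 * x) + 49 * (K * x)                               ≡⟨ e₁ K x ⟩
      500 * (K * x)                                              ≤⟨ *-monoʳ-≤ 500 dense ⟩
      500 * (16 * K * (l₁ + l₂ + l₃) + 16 * x)                   ≡⟨ e₂ K l₁ l₂ l₃ x ⟩
      16 * K * (500 * l₁ + 500 * l₂ + 500 * l₃) + 16 * (500 * x)  ≤⟨ +-mono-≤ (*-monoʳ-≤ (16 * K) sides)
                                                                      (≤-trans (≤-reflexive (sym (*-assoc 16 500 x)))
                                                                               (*-monoˡ-≤ x 8000≤K)) ⟩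
      16 * K * (3 * x + 500 * p) + K * x                         ≡⟨ e₃ K x p ⟩
      K * (8000 * p) + 49 * (K * x)                              ∎))
    where
    open ≤-Reasoning
    e₁ : ∀ K x → K * (451 * x) + 49 * (K * x) ≡ 500 * (K * x)
    e₁ = solve-∀
    e₂ : ∀ K a b c x → 500 * (16 * K * (a + b + c) + 16 * x) ≡
                       16 * K * (500 * a + 500 * b + 500 * c) + 16 * (500 * x)
    e₂ = solve-∀
    e₃ : ∀ K x p → 16 * K * (3 * x + 500 * p) + K * x ≡ K * (8000 * p) + 49 * (K * x)
    e₃ = solve-∀
    e₄ : ∀ x p → x + x + (500 * p + x) ≡ 3 * x + 500 * p
    e₄ = solve-∀
    sides : 500 * l₁ + 500 * l₂ + 500 * l₃ ≤ 3 * x + 500 * p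
    sides = begin
      500 * l₁ + 500 * l₂ + 500 * l₃   ≤⟨ +-mono-≤ (+-mono-≤ l₁-small l₂-small) (*-monoʳ-≤ 500 l₃≤p+e) ⟩
      x + x + 500 * (p + e)            ≡⟨ cong (x + x +_) (*-distribˡ-+ 500 p e) ⟩
      x + x + (500 * p + 500 * e)      ≤⟨ +-monoʳ-≤ (x + x) (+-monoʳ-≤ (500 * p) e-small) ⟩
      x + x + (500 * p + x)            ≡⟨ e₄ x p ⟩
      3 * x + 500 * p                  ∎

  -- With u + w + y ≤ 0.7525 n and u w ≥ 0.0564 n², the part y cannot exceed 1.8 w:
  -- otherwise AM-GM applied to 5u and 14w contradicts the bound on u + w + y.
  low-part-bound : ∀ {n y u w} → 400 * (y + u + w) ≤ 301 * n → 451 * (n * n) ≤ 8000 * (u * w) →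
                   5 * y ≤ 9 * w
  low-part-bound {n} {y} {u} {w} total product = ≮⇒≥ λ 9w<5y → <-irrefl refl (begin-strict
    90601 * (n * n)          ≤⟨ *-monoˡ-≤ (n * n) (m≤m+n 90601 10423) ⟩
    224 * 451 * (n * n)      ≡⟨ *-assoc 224 451 (n * n) ⟩
    224 * (451 * (n * n))    ≤⟨ *-monoʳ-≤ 224 product ⟩
    224 * (8000 * (u * w))   ≡⟨ trans (sym (*-assoc 224 8000 (u * w))) (*-assoc 6400 280 (u * w)) ⟩
    6400 * (280 * (u * w))   ≤⟨ *-monoʳ-≤ 6400 (subst (_≤ X * X) (e₁ u w) (4mn≤[m+n]² (5 * u) (14 * w))) ⟩
    6400 * (X * X)           ≡⟨ [m*n]*[o*p]≡[m*o]*[n*p] 80 X 80 X ⟨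
    (80 * X) * (80 * X)      <⟨ *-mono-< (80X<301n 9w<5y) (80X<301n 9w<5y) ⟩
    (301 * n) * (301 * n)    ≡⟨ [m*n]*[o*p]≡[m*o]*[n*p] 301 n 301 n ⟩
    90601 * (n * n)          ∎)
    where
    open ≤-Reasoning
    X = 5 * u + 14 * w
    e₁ : ∀ u w → 4 * ((5 * u) * (14 * w)) ≡ 280 * (u * w)
    e₁ = solve-∀
    e₂ : ∀ u w → 80 * (5 * u + 14 * w) ≡ 400 * (u + w) + 80 * (9 * w)
    e₂ = solve-∀
    e₃ : ∀ u w y → 400 * (u + w) + 80 * (5 * y) ≡ 400 * (y + u + w)
    e₃ = solve-∀
    80X<301n : 9 * w < 5 * y → 80 * X < 301 * n
    80X<301n 9w<5y = begin-strict
      80 * X                         ≡⟨ e₂ u w ⟩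
      400 * (u + w) + 80 * (9 * w)   <⟨ +-monoʳ-< (400 * (u + w)) (*-monoʳ-< 80 9w<5y) ⟩
      400 * (u + w) + 80 * (5 * y)   ≡⟨ e₃ u w y ⟩
      400 * (y + u + w)              ≤⟨ total ⟩
      301 * n                        ∎

  inside-bound : ∀ {l α c E} → 2 * l ≤ α * α + 4 * E → 5 * α ≤ 9 * c → 10 * l ≤ 9 * (c * α) + 20 * E
  inside-bound {l} {α} {c} {E} 2l≤ 5α≤9c = begin
    10 * l                   ≡⟨ *-assoc 5 2 l ⟩
    5 * (2 * l)              ≤⟨ *-monoʳ-≤ 5 2l≤ ⟩
    5 * (α * α + 4 * E)      ≡⟨ e₁ α E ⟩
    5 * α * α + 20 * E       ≤⟨ +-monoˡ-≤ (20 * E) (*-monoˡ-≤ α 5α≤9c) ⟩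
    9 * c * α + 20 * E       ≡⟨ cong (_+ 20 * E) (*-assoc 9 c α) ⟩
    9 * (c * α) + 20 * E     ∎
    where
    open ≤-Reasoning
    e₁ : ∀ α E → 5 * (α * α + 4 * E) ≡ 5 * α * α + 20 * E
    e₁ = solve-∀

  coefficient-weaken : ∀ {c d} x {N} → c ≤ d → d * x ≤ N → c * x ≤ N
  coefficient-weaken x c≤d d*x≤N = ≤-trans (*-monoˡ-≤ x c≤d) d*x≤N

  n²≡n*n : ∀ n → n ^ 2 ≡ n * n
  n²≡n*n n = cong (n *_) (*-identityʳ n)

  n³≡n*[n*n] : ∀ n → n ^ 3 ≡ n * (n * n)
  n³≡n*[n*n] n = cong (n *_) (n²≡n*n n)

  n⁴≡n*n*[n*n] : ∀ n → n ^ 4 ≡ (n * n) * (n * n)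
  n⁴≡n*n*[n*n] n = trans (cong (n *_) (n³≡n*[n*n] n)) (sym (*-assoc n n (n * n)))

module Scaled where

  open import Data.Nat using (_+_; _*_; _≤_; _<_; z≤n; s≤s; NonZero; >-nonZero⁻¹)
  open import Data.Nat.Properties
  open import Data.Nat.Tactic.RingSolver using (solve-∀)
  open import Relation.Binary.PropositionalEquality
  open Estimates

  -- The hypotheses for δ = 1/K, cleared of denominators.
  record ScaledHypotheses (K : ℕ) {n : ℕ} (L : Graph n) (P : Partition3 n) : Set where
    field
      K≤n            : K ≤ n
      L₁₂≤L₂₃        : L-between L P V1 V2 ≤ L-between L P V2 V3
      L₁₃≤L₂₃        : L-between L P V1 V3 ≤ L-between L P V2 V3
      parts-large    : ∀ i → K * n ≤ 4 * K * sizeV L P i + 4 * n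
      cross-dense    : K * (n * n) ≤
                       16 * K * (L-between L P V1 V2 + L-between L P V1 V3 + L-between L P V2 V3) + 16 * (n * n)
      quads-sparse   : ∀ h i j → h ≢ i → h ≢ j → i ≢ j → K * quads L P h i j ≤ (n * n) * (n * n)
      triples-sparse : ∀ i j → i ≢ j → K * triples L P i j ≤ n * (n * n)

  module _ {n : ℕ} (L : Graph n) (P : Partition3 n) (q : ℕ) .{{_ : NonZero q}}
           (H : ScaledHypotheses (1000000 * (q * q)) L P) where

    open ScaledHypotheses H
    open Counting L P
    open CrossSplit (500 * q)

    private
      K = 1000000 * (q * q)
      s₁ = sizeV L P V1
      s₂ = sizeV L P V2
      s₃ = sizeV L P V3
      L₁₂ = L-between L P V1 V2
      L₁₃ = L-between L P V1 V3
      L₂₃ = L-between L P V2 V3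
      e = S₂.lowDegree + S₃.lowDegree

    K-large : ∀ {c} → c ≤ 1000000 → c ≤ K
    K-large c≤ = ≤-trans c≤ (m≤m*n 1000000 (q * q) {{m*n≢0 q q}})

    0<n : 0 < n
    0<n = ≤-trans (K-large (s≤s z≤n)) K≤n

    s₂+s₃≤n : s₂ + s₃ ≤ n
    s₂+s₃≤n = ≤-trans (m≤n+m (s₂ + s₃) s₁) (≤-reflexive (trans (sym (+-assoc s₁ s₂ s₃)) sizeV-total))

    #low₂+#low₃≤n : S₂.#low + S₃.#low ≤ n
    #low₂+#low₃≤n = ≤-trans (+-mono-≤ S₂.#low≤sizeV S₃.#low≤sizeV) s₂+s₃≤n

    L₁ᵢ-small : ∀ {l} → K * (l * L₂₃) ≤ (n * n) * (n * n) → l ≤ L₂₃ → 500 * (q * l) ≤ n * n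
    L₁ᵢ-small {l} sparse l≤L₂₃ = subst (_≤ n * n) (*-assoc 500 q l)
      (sparse-product-factor-bound {a = 500 * q} {N = n * n} t²≤K sparse l≤L₂₃)
      where
      t²≤K : (500 * q) * (500 * q) ≤ K
      t²≤K = ≤-trans (≤-reflexive ([m*n]*[o*p]≡[m*o]*[n*p] 500 q 500 q))
                     (*-monoˡ-≤ (q * q) (m≤m+n 250000 750000))

    L₁₂-small : 500 * (q * L₁₂) ≤ n * n
    L₁₂-small = L₁ᵢ-small (subst (λ x → K * x ≤ (n * n) * (n * n)) (quads≡L-between*L-between V1 V2 V3)
                                 (quads-sparse V1 V2 V3 (λ ()) (λ ()) (λ ())))
                          L₁₂≤L₂₃

    L₁₃-small : 500 * (q * L₁₃) ≤ n * n
    L₁₃-small = L₁ᵢ-small (subst (λ x → K * x ≤ (n * n) * (n * n))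
                                 (trans (quads≡L-between*L-between V1 V3 V2) (cong (L₁₃ *_) (L-between-sym V3 V2)))
                                 (quads-sparse V1 V3 V2 (λ ()) (λ ()) (λ ())))
                          L₁₃≤L₂₃

    e-small : 500 * (q * e) ≤ n * n
    e-small = subst (_≤ n * n) (reorder e q)
      (low-degree-sums-bound {500 * q} {S₂.lowDegree} {S₃.lowDegree} {S₂.#low} {S₃.#low} {s₂} {s₃}
                             S₂.lowDegree*t≤#low*sizeV S₃.lowDegree*t≤#low*sizeV #low₂+#low₃≤n
                             (≤-trans (m≤m+n s₂ s₃) s₂+s₃≤n)
                             (≤-trans (m≤n+m s₃ s₂) s₂+s₃≤n))
      where
      reorder : ∀ e q → e * (500 * q) ≡ 500 * (q * e)
      reorder = solve-∀

    Eᵢ-small : ∀ {E r s} → K * r ≤ n * (n * n) → E * s ≤ r * (500 * q) → 6 * n ≤ 25 * s →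
               480 * (q * E) ≤ n * n
    Eᵢ-small {E} {r} {s} sparse E*s≤ 6n≤25s =
      *-cancelˡ-≤-pos 12500 (s≤s z≤n) (*-cancelˡ-≤-pos q (>-nonZero⁻¹ q) (begin
        q * (12500 * (480 * (q * E)))   ≡⟨ cong (q *_) (*-assoc 12500 480 (q * E)) ⟨
        q * (12500 * 480 * (q * E))     ≡⟨ e₁ 6 1000000 q E ⟨
        6 * K * E                       ≤⟨ high-degree-sum-bound {K} {n} {s} {E} {r} {500 * q} 0<n sparse E*s≤ 6n≤25s ⟩
        25 * (500 * q) * (n * n)        ≡⟨ e₂ 25 500 q (n * n) ⟩
        q * (12500 * (n * n))           ∎))
      where
      open ≤-Reasoning
      e₁ : ∀ a b q E → a * (b * (q * q)) * E ≡ q * (a * b * (q * E))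
      e₁ = solve-∀
      e₂ : ∀ a b q x → a * (b * q) * x ≡ q * (a * b * x)
      e₂ = solve-∀

    E₂-small : 480 * (q * S₂.highDegree) ≤ n * n
    E₂-small = Eᵢ-small (triples-sparse V2 V3 (λ ())) S₂.highDegree*sizeV≤triples*t
                        (quarter-part-lower-bound (K-large (m≤m+n 100 999900)) (parts-large V3))

    E₃-small : 480 * (q * S₃.highDegree) ≤ n * n
    E₃-small = Eᵢ-small (triples-sparse V3 V2 (λ ())) S₃.highDegree*sizeV≤triples*t
                        (quarter-part-lower-bound (K-large (m≤m+n 100 999900)) (parts-large V2))

    drop-q : ∀ {x} → 500 * (q * x) ≤ n * n → 500 * x ≤ n * n
    drop-q {x} = ≤-trans (*-monoʳ-≤ 500 (m≤n*m x q))

    high-product : 451 * (n * n) ≤ 8000 * (S₂.#high * S₃.#high)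
    high-product = high-product-lower-bound {K} {n * n} {L₁₂} {L₁₃} {L₂₃} {S₂.#high * S₃.#high} {e}
      (K-large (m≤m+n 8000 992000)) cross-dense L₂₃≤#high₂*#high₃+lowDegrees
      (drop-q L₁₂-small) (drop-q L₁₃-small) (drop-q e-small)

    parts₂₃-bound : 400 * (s₂ + s₃) ≤ 301 * n
    parts₂₃-bound = quarter-part-complement-bound {K} {n} {s₁} {s₂ + s₃} (K-large (m≤m+n 400 999600))
      (≤-reflexive (trans (+-comm (s₂ + s₃) s₁) (trans (sym (+-assoc s₁ s₂ s₃)) sizeV-total))) (parts-large V1)

    #low₂-bound : 5 * S₂.#low ≤ 9 * S₃.#high
    #low₂-bound = low-part-bound {n} {S₂.#low} {S₂.#high} {S₃.#high}
      (≤-trans (*-monoʳ-≤ 400 (+-mono-≤ (≤-reflexive (sym S₂.sizeV≡#low+#high)) S₃.#high≤sizeV)) parts₂₃-bound)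
      high-product

    #low₃-bound : 5 * S₃.#low ≤ 9 * S₂.#high
    #low₃-bound = low-part-bound {n} {S₃.#low} {S₃.#high} {S₂.#high}
      (≤-trans (*-monoʳ-≤ 400 (≤-trans (+-mono-≤ (≤-reflexive (sym S₃.sizeV≡#low+#high)) S₂.#high≤sizeV)
                                       (≤-reflexive (+-comm s₃ s₂))))
               parts₂₃-bound)
      (subst (λ p → 451 * (n * n) ≤ 8000 * p) (*-comm S₂.#high S₃.#high) high-product)

    missing-bound : S₃.#high * S₂.#low + S₂.#high * S₃.#low ≤ sizeM L P + e
    missing-bound = ≤-trans (+-monoˡ-≤ (S₂.#high * S₃.#low)
                              (≤-trans (*-monoˡ-≤ S₂.#low S₃.#high≤sizeV) (≤-reflexive (*-comm s₃ S₂.#low))))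
                            #low₂*sizeV₃+#high₂*#low₃≤sizeM+lowDegrees

    L₂₂-bound : 10 * L-inside L P V2 ≤ 9 * (S₃.#high * S₂.#low) + 20 * S₂.highDegree
    L₂₂-bound = inside-bound {L-inside L P V2} {S₂.#low} {S₃.#high} {S₂.highDegree}
                             S₂.double-L-inside≤#low²+4*highDegree #low₂-bound

    L₃₃-bound : 10 * L-inside L P V3 ≤ 9 * (S₂.#high * S₃.#low) + 20 * S₃.highDegree
    L₃₃-bound = inside-bound {L-inside L P V3} {S₃.#low} {S₂.#high} {S₃.highDegree}
                             S₃.double-L-inside≤#low²+4*highDegree #low₃-bound

    private
      Err = L₁₂ + L₁₃ + e + S₂.highDegree + S₃.highDegree

    ten-sizeB : 10 * sizeB L P ≤ 9 * sizeM L P + 20 * Err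
    ten-sizeB = begin
      10 * (L₁₂ + L₁₃ + L₂₂ + L₃₃)
        ≡⟨ e₁ L₁₂ L₁₃ L₂₂ L₃₃ ⟩
      10 * L₁₂ + 10 * L₁₃ + 10 * L₂₂ + 10 * L₃₃
        ≤⟨ +-mono-≤ (+-monoʳ-≤ (10 * L₁₂ + 10 * L₁₃) L₂₂-bound) L₃₃-bound ⟩
      10 * L₁₂ + 10 * L₁₃ + (9 * (c * α) + 20 * E₂) + (9 * (b * β) + 20 * E₃)
        ≡⟨ e₂ L₁₂ L₁₃ (c * α) (b * β) E₂ E₃ ⟩
      9 * (c * α + b * β) + (10 * L₁₂ + 10 * L₁₃ + 20 * E₂ + 20 * E₃)
        ≤⟨ +-monoˡ-≤ (10 * L₁₂ + 10 * L₁₃ + 20 * E₂ + 20 * E₃) (*-monoʳ-≤ 9 missing-bound) ⟩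
      9 * (sizeM L P + e) + (10 * L₁₂ + 10 * L₁₃ + 20 * E₂ + 20 * E₃)
        ≡⟨ e₃ (sizeM L P) e L₁₂ L₁₃ E₂ E₃ ⟩
      9 * sizeM L P + (10 * L₁₂ + 10 * L₁₃ + 9 * e + 20 * E₂ + 20 * E₃)
        ≤⟨ +-monoʳ-≤ (9 * sizeM L P) (≤-trans (m≤m+n _ (10 * L₁₂ + 10 * L₁₃ + 11 * e))
                                              (≤-reflexive (e₄ L₁₂ L₁₃ e E₂ E₃))) ⟩
      9 * sizeM L P + 20 * Err ∎
      where
      open ≤-Reasoning
      L₂₂ = L-inside L P V2
      L₃₃ = L-inside L P V3
      α = S₂.#low
      b = S₂.#high
      β = S₃.#low
      c = S₃.#high
      E₂ = S₂.highDegree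
      E₃ = S₃.highDegree
      e₁ : ∀ a b c d → 10 * (a + b + c + d) ≡ 10 * a + 10 * b + 10 * c + 10 * d
      e₁ = solve-∀
      e₂ : ∀ a b x y E F → 10 * a + 10 * b + (9 * x + 20 * E) + (9 * y + 20 * F) ≡
                           9 * (x + y) + (10 * a + 10 * b + 20 * E + 20 * F)
      e₂ = solve-∀
      e₃ : ∀ M e a b E F → 9 * (M + e) + (10 * a + 10 * b + 20 * E + 20 * F) ≡
                           9 * M + (10 * a + 10 * b + 9 * e + 20 * E + 20 * F)
      e₃ = solve-∀
      e₄ : ∀ a b e E F → 10 * a + 10 * b + 9 * e + 20 * E + 20 * F + (10 * a + 10 * b + 11 * e) ≡
                         20 * (a + b + e + E + F)
      e₄ = solve-∀

    errors-small : 20 * (q * Err) ≤ 5 * (n * n)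
    errors-small = begin
      20 * (q * Err)
        ≡⟨ e₁ q L₁₂ L₁₃ e S₂.highDegree S₃.highDegree ⟩
      20 * (q * L₁₂) + 20 * (q * L₁₃) + 20 * (q * e) + 20 * (q * S₂.highDegree) + 20 * (q * S₃.highDegree)
        ≤⟨ +-mono-≤ (+-mono-≤ (+-mono-≤ (+-mono-≤ (to-20 L₁₂-small) (to-20 L₁₃-small)) (to-20 e-small))
                              (coefficient-weaken {20} {480} (q * S₂.highDegree) (m≤m+n 20 460) E₂-small))
                    (coefficient-weaken {20} {480} (q * S₃.highDegree) (m≤m+n 20 460) E₃-small) ⟩
      n * n + n * n + n * n + n * n + n * n
        ≡⟨ e₂ (n * n) ⟩
      5 * (n * n) ∎
      where
      open ≤-Reasoning
      to-20 : ∀ {x} → 500 * (q * x) ≤ n * n → 20 * (q * x) ≤ n * n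
      to-20 {x} = coefficient-weaken {20} {500} (q * x) (m≤m+n 20 480)
      e₁ : ∀ q a b c d f → 20 * (q * (a + b + c + d + f)) ≡
                           20 * (q * a) + 20 * (q * b) + 20 * (q * c) + 20 * (q * d) + 20 * (q * f)
      e₁ = solve-∀
      e₂ : ∀ x → x + x + x + x + x ≡ 5 * x
      e₂ = solve-∀

    scaled-proposition : 10 * q * sizeB L P ≤ 9 * q * sizeM L P + 5 * (n * n)
    scaled-proposition = begin
      10 * q * sizeB L P                   ≡⟨ e₁ q (sizeB L P) ⟩
      q * (10 * sizeB L P)                 ≤⟨ *-monoʳ-≤ q ten-sizeB ⟩
      q * (9 * sizeM L P + 20 * Err)       ≡⟨ e₂ q (sizeM L P) Err ⟩
      9 * q * sizeM L P + 20 * (q * Err)   ≤⟨ +-monoʳ-≤ (9 * q * sizeM L P) errors-small ⟩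
      9 * q * sizeM L P + 5 * (n * n)      ∎
      where
      open ≤-Reasoning
      e₁ : ∀ q b → 10 * q * b ≡ q * (10 * b)
      e₁ = solve-∀
      e₂ : ∀ q m r → q * (9 * m + 20 * r) ≡ 9 * q * m + 20 * (q * r)
      e₂ = solve-∀

module Rationals where

  open import Data.Integer as ℤ using (ℤ; +_)
  import Data.Integer.Properties as ℤ
  open import Data.Nat as ℕ using (zero; suc; _^_)
  import Data.Nat.Properties as ℕ
  open import Data.Nat.Divisibility using (∣1⇒≡1)
  open import Data.Product using (_,_)
  open import Data.Rational
  open import Data.Rational.Properties
  import Data.Rational.Unnormalised as ℚᵘ
  import Data.Rational.Unnormalised.Properties as ℚᵘ
  open import Data.Rational.Solver using (module +-*-Solver)
  open +-*-Solver using (solve; _:+_; _:*_; _:-_; _:=_; con)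
  open import Relation.Binary.PropositionalEquality
  open Estimates using (n²≡n*n; n³≡n*[n*n]; n⁴≡n*n*[n*n])
  open Scaled using (ScaledHypotheses)

  ℚ[]≡mkℚ : ∀ m → ℚ[ m ] ≡ mkℚ (+ m) 0 (λ (_ , d∣1) → ∣1⇒≡1 d∣1)
  ℚ[]≡mkℚ m = normalize-coprime {m} {0} (λ (_ , d∣1) → ∣1⇒≡1 d∣1)

  ℚ[]-homo-+ : ∀ a b → ℚ[ a ] + ℚ[ b ] ≡ ℚ[ a ℕ.+ b ]
  ℚ[]-homo-+ a b = trans (cong₂ _+_ (ℚ[]≡mkℚ a) (ℚ[]≡mkℚ b))
    (cong (_/ 1) (cong₂ ℤ._+_ (ℤ.*-identityʳ (+ a)) (ℤ.*-identityʳ (+ b))))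

  ℚ[]-homo-* : ∀ a b → ℚ[ a ] * ℚ[ b ] ≡ ℚ[ a ℕ.* b ]
  ℚ[]-homo-* a b = trans (cong₂ _*_ (ℚ[]≡mkℚ a) (ℚ[]≡mkℚ b)) (cong (_/ 1) (sym (ℤ.pos-* a b)))

  ℚ[]-cancel-≤ : ∀ {a b} → ℚ[ a ] ≤ ℚ[ b ] → a ℕ.≤ b
  ℚ[]-cancel-≤ {a} {b} a≤b with drop-*≤* (subst₂ _≤_ (ℚ[]≡mkℚ a) (ℚ[]≡mkℚ b) a≤b)
  ... | a*1≤b*1 rewrite ℤ.*-identityʳ (+ a) | ℤ.*-identityʳ (+ b) = ℤ.drop‿+≤+ a*1≤b*1

  ℚ[]-mono-≤ : ∀ {a b} → a ℕ.≤ b → ℚ[ a ] ≤ ℚ[ b ]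
  ℚ[]-mono-≤ {a} {b} a≤b = subst₂ _≤_ (sym (ℚ[]≡mkℚ a)) (sym (ℚ[]≡mkℚ b))
    (*≤* (subst₂ ℤ._≤_ (sym (ℤ.*-identityʳ (+ a))) (sym (ℤ.*-identityʳ (+ b))) (ℤ.+≤+ a≤b)))

  *-monoˡ-≤-ℚ[] : ∀ m {p r} → p ≤ r → ℚ[ m ] * p ≤ ℚ[ m ] * r
  *-monoˡ-≤-ℚ[] m {p} {r} = *-monoˡ-≤-nonNeg ℚ[ m ] {{normalize-nonNeg m 1}} {p} {r}

  1≤p*↧ₙp : ∀ p → 0ℚ < p → 1ℚ ≤ p * ℚ[ ↧ₙ p ]
  1≤p*↧ₙp (mkℚ (+ zero) _ _) 0<p with drop-*<* 0<p
  ... | ℤ.+<+ ()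
  1≤p*↧ₙp (mkℚ ℤ.-[1+ _ ] _ _) 0<p with drop-*<* 0<p
  ... | ()
  1≤p*↧ₙp p@(mkℚ (+ suc a) d _) _ = toℚᵘ-cancel-≤
    (ℚᵘ.≤-respʳ-≃ (ℚᵘ.≃-sym (toℚᵘ-homo-* p ℚ[ suc d ]))
      (subst (λ r → toℚᵘ 1ℚ ℚᵘ.≤ toℚᵘ p ℚᵘ.* toℚᵘ r) (sym (ℚ[]≡mkℚ (suc d)))
        (ℚᵘ.*≤* (ℤ.+≤+ (ℕ.s≤s (ℕ.≤-trans (ℕ.≤-reflexive (ℕ.+-identityʳ (d ℕ.* 1)))
                                          (ℕ.*-monoˡ-≤ 1 (ℕ.m≤m+n d (a ℕ.* suc d)))))))))

  a-b≤c⇒a≤c+b : ∀ {a b c} → a - b ≤ c → a ≤ c + b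
  a-b≤c⇒a≤c+b {a} {b} {c} a-b≤c =
    subst (_≤ c + b) (solve 2 (λ a b → (a :- b) :+ b := a) refl a b) (+-monoˡ-≤ b a-b≤c)

  a≤b+c⇒a-b≤c : ∀ {a b c} → a ≤ b + c → a - b ≤ c
  a≤b+c⇒a-b≤c {a} {b} {c} a≤b+c =
    subst (a - b ≤_) (solve 2 (λ b c → (b :+ c) :- b := c) refl b c) (+-monoˡ-≤ (- b) a≤b+c)

  module Reciprocal (K : ℕ) .{{_ : ℕ.NonZero K}} where

    instance
      ℚ[K]-pos : Positive ℚ[ K ]
      ℚ[K]-pos = normalize-pos K 1
      ℚ[K]-nonZero : NonZero ℚ[ K ]
      ℚ[K]-nonZero = pos⇒nonZero ℚ[ K ]

    δ : ℚ
    δ = 1/ ℚ[ K ]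

    0<δ : 0ℚ < δ
    0<δ = positive⁻¹ δ {{1/pos⇒pos ℚ[ K ]}}

    K*δ≡1 : ℚ[ K ] * δ ≡ 1ℚ
    K*δ≡1 = *-inverseʳ ℚ[ K ]

    K≤n-from : ∀ {n} → 1ℚ ≤ ℚ[ n ] * δ → K ℕ.≤ n
    K≤n-from {n} 1≤nδ = ℚ[]-cancel-≤ {K} {n} (subst₂ _≤_ (*-identityʳ ℚ[ K ]) K*nδ≡n (*-monoˡ-≤-ℚ[] K 1≤nδ))
      where
      K*nδ≡n : ℚ[ K ] * (ℚ[ n ] * δ) ≡ ℚ[ n ]
      K*nδ≡n = trans (solve 3 (λ k n d → k :* (n :* d) := n :* (k :* d)) refl ℚ[ K ] ℚ[ n ] δ)
                     (trans (cong (ℚ[ n ] *_) K*δ≡1) (*-identityʳ ℚ[ n ]))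

    K*m≤N-from : ∀ {m N} → ℚ[ m ] ≤ δ * ℚ[ N ] → K ℕ.* m ℕ.≤ N
    K*m≤N-from {m} {N} m≤δN = ℚ[]-cancel-≤ {K ℕ.* m} {N} (subst₂ _≤_ (ℚ[]-homo-* K m) K*δN≡N (*-monoˡ-≤-ℚ[] K m≤δN))
      where
      K*δN≡N : ℚ[ K ] * (δ * ℚ[ N ]) ≡ ℚ[ N ]
      K*δN≡N = trans (sym (*-assoc ℚ[ K ] δ ℚ[ N ])) (trans (cong (_* ℚ[ N ]) K*δ≡1) (*-identityˡ ℚ[ N ]))

    K*X≤D*K*Y+D*X-from : ∀ D {X Y} (f : ℚ) → ℚ[ D ] * f ≡ 1ℚ → (f - δ) * ℚ[ X ] ≤ ℚ[ Y ] →
                         K ℕ.* X ℕ.≤ D ℕ.* K ℕ.* Y ℕ.+ D ℕ.* X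
    K*X≤D*K*Y+D*X-from D {X} {Y} f Df≡1 [f-δ]X≤Y = ℚ[]-cancel-≤ {K ℕ.* X} {D ℕ.* K ℕ.* Y ℕ.+ D ℕ.* X}
      (subst₂ _≤_ (ℚ[]-homo-* K X)
                  (trans (cong (_+ ℚ[ D ℕ.* X ]) (ℚ[]-homo-* (D ℕ.* K) Y)) (ℚ[]-homo-+ (D ℕ.* K ℕ.* Y) (D ℕ.* X)))
                  (a-b≤c⇒a≤c+b (subst (_≤ ℚ[ D ℕ.* K ] * ℚ[ Y ]) expand (*-monoˡ-≤-ℚ[] (D ℕ.* K) [f-δ]X≤Y))))
      where
      expand : ℚ[ D ℕ.* K ] * ((f - δ) * ℚ[ X ]) ≡ ℚ[ K ] * ℚ[ X ] - ℚ[ D ℕ.* X ]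
      expand = begin
        ℚ[ D ℕ.* K ] * ((f - δ) * ℚ[ X ])
          ≡⟨ cong (_* ((f - δ) * ℚ[ X ])) (ℚ[]-homo-* D K) ⟨
        (ℚ[ D ] * ℚ[ K ]) * ((f - δ) * ℚ[ X ])
          ≡⟨ solve 5 (λ d k f e x → (d :* k) :* ((f :- e) :* x) := (d :* f) :* (k :* x) :- d :* (k :* e) :* x)
                   refl ℚ[ D ] ℚ[ K ] f δ ℚ[ X ] ⟩
        (ℚ[ D ] * f) * (ℚ[ K ] * ℚ[ X ]) - ℚ[ D ] * (ℚ[ K ] * δ) * ℚ[ X ]
          ≡⟨ cong₂ (λ u v → u * (ℚ[ K ] * ℚ[ X ]) - ℚ[ D ] * v * ℚ[ X ]) Df≡1 K*δ≡1 ⟩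
        1ℚ * (ℚ[ K ] * ℚ[ X ]) - ℚ[ D ] * 1ℚ * ℚ[ X ]
          ≡⟨ solve 3 (λ k x d → con 1ℚ :* (k :* x) :- d :* con 1ℚ :* x := k :* x :- d :* x) refl ℚ[ K ] ℚ[ X ] ℚ[ D ] ⟩
        ℚ[ K ] * ℚ[ X ] - ℚ[ D ] * ℚ[ X ]
          ≡⟨ cong (_-_ (ℚ[ K ] * ℚ[ X ])) (ℚ[]-homo-* D X) ⟩
        ℚ[ K ] * ℚ[ X ] - ℚ[ D ℕ.* X ] ∎
        where open ≡-Reasoning

  module _ (K : ℕ) .{{_ : ℕ.NonZero K}} where

    open Reciprocal K

    scale-hypotheses : ∀ {n} (L : Graph n) (P : Partition3 n) → 1ℚ ≤ ℚ[ n ] * δ →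
      ℚ[ L-between L P V1 V2 ] ⊔ ℚ[ L-between L P V1 V3 ] ≤ ℚ[ L-between L P V2 V3 ] →
      ((i : Fin 3) → (+ 1 / 4 - δ) * ℚ[ n ] ≤ ℚ[ sizeV L P i ]) →
      (+ 1 / 16 - δ) * ℚ[ n ^ 2 ]
        ≤ ℚ[ L-between L P V1 V2 ] + ℚ[ L-between L P V1 V3 ] + ℚ[ L-between L P V2 V3 ] →
      ((h i j : Fin 3) → h ≢ i → h ≢ j → i ≢ j → ℚ[ quads L P h i j ] ≤ δ * ℚ[ n ^ 4 ]) →
      ((i j : Fin 3) → i ≢ j → ℚ[ triples L P i j ] ≤ δ * ℚ[ n ^ 3 ]) →
      ScaledHypotheses K L P
    scale-hypotheses {n} L P 1≤nδ L₂₃-max parts dense quads-small triples-small = record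
      { K≤n            = K≤n-from 1≤nδ
      ; L₁₂≤L₂₃        = ℚ[]-cancel-≤ {L₁₂} {L₂₃} (p⊔q≤r⇒p≤r ℚ[ L₁₂ ] ℚ[ L₁₃ ] L₂₃-max)
      ; L₁₃≤L₂₃        = ℚ[]-cancel-≤ {L₁₃} {L₂₃} (p⊔q≤r⇒q≤r ℚ[ L₁₂ ] ℚ[ L₁₃ ] L₂₃-max)
      ; parts-large    = λ i → K*X≤D*K*Y+D*X-from 4 (+ 1 / 4) refl (parts i)
      ; cross-dense    = subst (λ x → K ℕ.* x ℕ.≤ 16 ℕ.* K ℕ.* (L₁₂ ℕ.+ L₁₃ ℕ.+ L₂₃) ℕ.+ 16 ℕ.* x) (n²≡n*n n)
                           (K*X≤D*K*Y+D*X-from 16 (+ 1 / 16) refl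
                             (subst ((+ 1 / 16 - δ) * ℚ[ n ^ 2 ] ≤_) ℚ[L₁₂+L₁₃+L₂₃] dense))
      ; quads-sparse   = λ h i j h≢i h≢j i≢j →
                           subst (K ℕ.* quads L P h i j ℕ.≤_) (n⁴≡n*n*[n*n] n)
                                 (K*m≤N-from (quads-small h i j h≢i h≢j i≢j))
      ; triples-sparse = λ i j i≢j →
                           subst (K ℕ.* triples L P i j ℕ.≤_) (n³≡n*[n*n] n) (K*m≤N-from (triples-small i j i≢j))
      }
      where
      L₁₂ = L-between L P V1 V2
      L₁₃ = L-between L P V1 V3
      L₂₃ = L-between L P V2 V3
      ℚ[L₁₂+L₁₃+L₂₃] : ℚ[ L₁₂ ] + ℚ[ L₁₃ ] + ℚ[ L₂₃ ] ≡ ℚ[ L₁₂ ℕ.+ L₁₃ ℕ.+ L₂₃ ]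
      ℚ[L₁₂+L₁₃+L₂₃] = trans (cong (_+ ℚ[ L₂₃ ]) (ℚ[]-homo-+ L₁₂ L₁₃)) (ℚ[]-homo-+ (L₁₂ ℕ.+ L₁₃) L₂₃)

  unscale-conclusion : ∀ (ε : ℚ) q .{{_ : ℕ.NonZero q}} B M n → 1ℚ ≤ ε * ℚ[ q ] →
    10 ℕ.* q ℕ.* B ℕ.≤ 9 ℕ.* q ℕ.* M ℕ.+ 5 ℕ.* (n ℕ.* n) →
    ℚ[ B ] - (+ 9 / 10) * ℚ[ M ] ≤ ε * ℚ[ n ^ 2 ]
  unscale-conclusion ε q B M n 1≤εq scaled =
    *-cancelˡ-≤-pos ℚ[ 10 ℕ.* q ] {{normalize-pos (10 ℕ.* q) 1 {{_}} {{ℕ.m*n≢0 10 q}}}} (begin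
      ℚ[ 10 ℕ.* q ] * (ℚ[ B ] - (+ 9 / 10) * ℚ[ M ])
        ≡⟨ cong (_* (ℚ[ B ] - (+ 9 / 10) * ℚ[ M ])) (ℚ[]-homo-* 10 q) ⟨
      ℚ[ 10 ] * ℚ[ q ] * (ℚ[ B ] - (+ 9 / 10) * ℚ[ M ])
        ≡⟨ solve 5 (λ t q b c m → t :* q :* (b :- c :* m) := t :* q :* b :- (t :* c) :* q :* m)
                 refl ℚ[ 10 ] ℚ[ q ] ℚ[ B ] (+ 9 / 10) ℚ[ M ] ⟩
      ℚ[ 10 ] * ℚ[ q ] * ℚ[ B ] - ℚ[ 9 ] * ℚ[ q ] * ℚ[ M ]
        ≡⟨ cong₂ (λ u v → u - v) (trans (cong (_* ℚ[ B ]) (ℚ[]-homo-* 10 q)) (ℚ[]-homo-* (10 ℕ.* q) B))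
                                 (trans (cong (_* ℚ[ M ]) (ℚ[]-homo-* 9 q)) (ℚ[]-homo-* (9 ℕ.* q) M)) ⟩
      ℚ[ 10 ℕ.* q ℕ.* B ] - ℚ[ 9 ℕ.* q ℕ.* M ]
        ≤⟨ a≤b+c⇒a-b≤c (subst (ℚ[ 10 ℕ.* q ℕ.* B ] ≤_) (sym (ℚ[]-homo-+ (9 ℕ.* q ℕ.* M) (5 ℕ.* N)))
                              (ℚ[]-mono-≤ scaled)) ⟩
      ℚ[ 5 ℕ.* N ]
        ≤⟨ ℚ[]-mono-≤ (ℕ.*-monoˡ-≤ N (ℕ.m≤m+n 5 5)) ⟩
      ℚ[ 10 ℕ.* N ]
        ≡⟨ trans (sym (ℚ[]-homo-* 10 N)) (cong (ℚ[ 10 ] *_) (sym (*-identityˡ ℚ[ N ]))) ⟩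
      ℚ[ 10 ] * (1ℚ * ℚ[ N ])
        ≤⟨ *-monoˡ-≤-ℚ[] 10 (*-monoʳ-≤-nonNeg ℚ[ N ] {{normalize-nonNeg N 1}} {1ℚ} {ε * ℚ[ q ]} 1≤εq) ⟩
      ℚ[ 10 ] * (ε * ℚ[ q ] * ℚ[ N ])
        ≡⟨ solve 4 (λ t e q n → t :* (e :* q :* n) := (t :* q) :* (e :* n)) refl ℚ[ 10 ] ε ℚ[ q ] ℚ[ N ] ⟩
      ℚ[ 10 ] * ℚ[ q ] * (ε * ℚ[ N ])
        ≡⟨ cong₂ (λ u v → u * (ε * ℚ[ v ])) (ℚ[]-homo-* 10 q) (sym (n²≡n*n n)) ⟩
      ℚ[ 10 ℕ.* q ] * (ε * ℚ[ n ^ 2 ]) ∎)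
    where
    open ≤-Reasoning
    N = n ℕ.* n

open import Data.Integer using (+_)
open import Data.Nat as ℕ using (_^_)
open import Data.Product using (Σ; _×_; _,_)
open import Data.Rational using (ℚ; _/_; _<_; _≤_; _+_; _-_; _*_; 0ℚ; 1ℚ; _⊔_; ↧ₙ_)
open import Relation.Binary.PropositionalEquality using (_≢_)
open Rationals using (1≤p*↧ₙp; module Reciprocal; scale-hypotheses; unscale-conclusion)
open Scaled using (scaled-proposition)

proposition3p4 :
    (ε : ℚ) → 0ℚ < ε →
    Σ ℚ λ δ → 0ℚ < δ ×
      ((n : ℕ) → 1ℚ ≤ ℚ[ n ] * δ →
       (L : Graph n) (P : Partition3 n) →
       ℚ[ L-between L P V1 V2 ] ⊔ ℚ[ L-between L P V1 V3 ] ≤ ℚ[ L-between L P V2 V3 ] →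
       ((i : Fin 3) → (+ 1 / 4 - δ) * ℚ[ n ] ≤ ℚ[ sizeV L P i ]) →
       (+ 1 / 16 - δ) * ℚ[ n ^ 2 ]
         ≤ ℚ[ L-between L P V1 V2 ] + ℚ[ L-between L P V1 V3 ] + ℚ[ L-between L P V2 V3 ] →
       ((h i j : Fin 3) → h ≢ i → h ≢ j → i ≢ j →
         ℚ[ quads L P h i j ] ≤ δ * ℚ[ n ^ 4 ]) →
       ((i j : Fin 3) → i ≢ j →
         ℚ[ triples L P i j ] ≤ δ * ℚ[ n ^ 3 ]) →
       ℚ[ sizeB L P ] - (+ 9 / 10) * ℚ[ sizeM L P ] ≤ ε * ℚ[ n ^ 2 ])
proposition3p4 ε 0<ε = δ , 0<δ , λ n 1≤nδ L P L₂₃-max parts dense quads-sparse triples-sparse →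
  unscale-conclusion ε q (sizeB L P) (sizeM L P) n (1≤p*↧ₙp ε 0<ε)
    (scaled-proposition L P q (scale-hypotheses K L P 1≤nδ L₂₃-max parts dense quads-sparse triples-sparse))
  where
  q = ↧ₙ ε
  K = 1000000 ℕ.* (q ℕ.* q)
  open Reciprocal K
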